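{- For every $n\in\mathbb{N}$, the preorder $T_n^*$ on the vertices of the twisted cube $T_n$ is isomorphic to the total order $(\{0,1\}^{n},<)$ (equivalently, to the total order on $2^n$ elements); in particular it is a total order (antisymmetric and total).
   Context: A graph is $(V,E)$ with $E\subseteq V\times V$. For a graph $G$, $G^*$ is the preorder on its vertices with $u\le v$ iff there is a directed chain of edges from $u$ to $v$. The twisted $n$-cube $T_n$ is the graph with vertex set $\{0,1\}^n$ (sequences $x_0x_1\cdots x_{n-1}$) and edges: a loop at each vertex, and for each $i\in\{0,\dots,n-1\}$ and each $y=y_0\cdots y_{n-2}\in\{0,1\}^{n-1}$ an edge from $y_0\cdots y_{i-1}\,b\,y_i\cdots y_{n-2}$ to $y_0\cdots y_{i-1}\,(1-b)\,y_i\cdots y_{n-2}$, where $b=1$ if the number of zeros among $y_0,\dots,y_{i-1}$ is odd and $b=0$ otherwise. (Equivalently, $T_0$ is one vertex with a loop, and $T_{n+1}$ has vertices $\{0,1\}\times V(T_n)$ with an edge $(0,t)\to(0,s)$ and $(1,s)\to(1,t)$ for each edge $s\to t$ of $T_n$, and an edge $(0,v)\to(1,v)$ for each vertex $v$.) $(\{0,1\}^n,<)$ denotes binary sequences ordered as binary numbers. -}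

module Defs where

open import Data.Nat using (ℕ; zero; suc; _+_; _*_; _^_; _≤_)
open import Data.Bool using (Bool; true; false)
open import Data.Vec using (Vec; []; _∷_)
open import Relation.Binary.Construct.Closure.ReflexiveTransitive using (Star)

Vertex : ℕ → Set
Vertex n = Vec Bool n

-- Edge relation of the twisted n-cube, following the recursive description:
-- T₀ is one vertex with a loop; T_{n+1} has vertices {0,1} × V(T_n),
-- an edge (0,t)→(0,s) and (1,s)→(1,t) for each edge s→t of T_n,
-- and an edge (0,v)→(1,v) for each vertex v.  (false = 0, true = 1.)
data Edge : (n : ℕ) → Vertex n → Vertex n → Set where
  loop0 : Edge zero [] []
  low   : ∀ {n} {s t : Vertex n} → Edge n s t → Edge (suc n) (false ∷ t) (false ∷ s)
  high  : ∀ {n} {s t : Vertex n} → Edge n s t → Edge (suc n) (true ∷ s) (true ∷ t)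
  cross : ∀ {n} (v : Vertex n) → Edge (suc n) (false ∷ v) (true ∷ v)

-- The preorder T_n^* : u ≤ v iff there is a directed chain of edges from u to v
-- (reflexive-transitive closure; reflexivity is automatic since every vertex has a loop).
Reach : (n : ℕ) → Vertex n → Vertex n → Set
Reach n = Star (Edge n)

bit : Bool → ℕ
bit false = 0
bit true  = 1

value : ∀ {n} → Vec Bool n → ℕ
value {zero}  []       = 0
value {suc n} (b ∷ xs) = bit b * 2 ^ n + value xs

_≤bin_ : ∀ {n} → Vec Bool n → Vec Bool n → Set
x ≤bin y = value x ≤ value y

-- The vertices of T_{n+1} whose first coordinate is 1 form a copy of T_n lying
-- above the copy with first coordinate 0 (every vertex of the lower copy has a
-- cross edge into the upper one), and inside the lower copy all edges of T_n
-- are reversed. On binary numbers, reversing the order of {0,1}^n is bitwise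
-- complementation, so by induction the map rank, which keeps the first bit and
-- complements the rank of the tail when that bit is 0, is an order isomorphism
-- from T_n^* onto ({0,1}^n, ≤).
module Submission where

open import Defs
open import Data.Nat using (ℕ; zero; suc; _+_; _*_; _^_; _≤_; _<_; z≤n; s≤s)
open import Data.Nat.Properties
open import Data.Nat.Tactic.RingSolver using (solve-∀)
open import Data.Bool using (Bool; true; false; not)
open import Data.Bool.Properties using (not-involutive)
open import Data.Vec using (Vec; []; _∷_)
open import Data.Product using (Σ; _×_; _,_; proj₁)
open import Data.Sum using (_⊎_; inj₁; inj₂; map)
open import Data.Empty using (⊥-elim)
open import Function using (id; _∘_)
open import Function.Definitions using (Bijective; Injective)
open import Function.Consequences.Propositional
  using (inverseᵇ⇒bijective; strictlyInverseˡ⇒inverseˡ; strictlyInverseʳ⇒inverseʳ)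
open import Relation.Binary.PropositionalEquality
open import Relation.Binary.Construct.Closure.ReflexiveTransitive
  using (Star; ε; _◅_; _◅◅_; gmap; reverse)

complement : ∀ {n} → Vec Bool n → Vec Bool n
complement []       = []
complement (b ∷ xs) = not b ∷ complement xs

complement-involutive : ∀ {n} (x : Vec Bool n) → complement (complement x) ≡ x
complement-involutive []       = refl
complement-involutive (b ∷ xs) =
  cong₂ _∷_ (not-involutive b) (complement-involutive xs)

bit-not+bit : ∀ b → bit (not b) + bit b ≡ 1
bit-not+bit false = refl
bit-not+bit true  = refl

suc[value-complement+value] : ∀ {n} (x : Vec Bool n) →
  suc (value (complement x) + value x) ≡ 2 ^ n
suc[value-complement+value] []                 = refl
suc[value-complement+value] {suc n} (b ∷ xs) = begin
  suc (bit (not b) * 2 ^ n + value (complement xs) + (bit b * 2 ^ n + value xs))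
    ≡⟨ rearrange (bit (not b)) (bit b) (2 ^ n) (value (complement xs)) (value xs) ⟩
  (bit (not b) + bit b) * 2 ^ n + suc (value (complement xs) + value xs)
    ≡⟨ cong₂ (λ k m → k * 2 ^ n + m) (bit-not+bit b) (suc[value-complement+value] xs) ⟩
  1 * 2 ^ n + 2 ^ n
    ≡⟨ double (2 ^ n) ⟩
  2 * 2 ^ n
    ∎
  where
  open ≡-Reasoning
  rearrange : ∀ a b p u v → suc (a * p + u + (b * p + v)) ≡ (a + b) * p + suc (u + v)
  rearrange = solve-∀
  double : ∀ p → 1 * p + p ≡ 2 * p
  double = solve-∀

value<2^n : ∀ {n} (x : Vec Bool n) → value x < 2 ^ n
value<2^n x = subst (value x <_) (suc[value-complement+value] x) (s≤s (m≤n+m _ _))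

value-complement-antitone : ∀ {n} (x y : Vec Bool n) →
  x ≤bin y → complement y ≤bin complement x
value-complement-antitone x y x≤y = +-cancelʳ-≤ (value x) _ _ (begin
  value (complement y) + value x ≤⟨ +-monoʳ-≤ (value (complement y)) x≤y ⟩
  value (complement y) + value y ≡⟨ suc-injective complement-sums ⟩
  value (complement x) + value x ∎)
  where
  open ≤-Reasoning
  complement-sums : suc (value (complement y) + value y) ≡ suc (value (complement x) + value x)
  complement-sums = trans (suc[value-complement+value] y) (sym (suc[value-complement+value] x))

value-complement-reflects : ∀ {n} (x y : Vec Bool n) →
  complement y ≤bin complement x → x ≤bin y
value-complement-reflects x y c≤c =
  subst₂ _≤bin_ (complement-involutive x) (complement-involutive y)
    (value-complement-antitone (complement y) (complement x) c≤c)

value-false<true : ∀ {n} (x y : Vec Bool n) → value (false ∷ x) < value (true ∷ y)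
value-false<true {n} x y = begin-strict
  value x           <⟨ value<2^n x ⟩
  2 ^ n             ≡⟨ sym (*-identityˡ (2 ^ n)) ⟩
  1 * 2 ^ n         ≤⟨ m≤m+n (1 * 2 ^ n) (value y) ⟩
  value (true ∷ y)  ∎
  where open ≤-Reasoning

value-cons-cancel : ∀ {n} b (x y : Vec Bool n) → (b ∷ x) ≤bin (b ∷ y) → x ≤bin y
value-cons-cancel {n} b x y = +-cancelˡ-≤ (bit b * 2 ^ n) (value x) (value y)

value-cons-mono : ∀ {n} b (x y : Vec Bool n) → x ≤bin y → (b ∷ x) ≤bin (b ∷ y)
value-cons-mono {n} b x y = +-monoʳ-≤ (bit b * 2 ^ n)

value-injective : ∀ {n} (x y : Vec Bool n) → value x ≡ value y → x ≡ y
value-injective []          []          _ = refl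
value-injective (false ∷ x) (false ∷ y) e = cong (false ∷_) (value-injective x y e)
value-injective {suc n} (true ∷ x) (true ∷ y) e =
  cong (true ∷_) (value-injective x y (+-cancelˡ-≡ (1 * 2 ^ n) (value x) (value y) e))
value-injective (false ∷ x) (true ∷ y)  e = ⊥-elim (<-irrefl e (value-false<true x y))
value-injective (true ∷ x)  (false ∷ y) e = ⊥-elim (<-irrefl (sym e) (value-false<true y x))

rank : ∀ {n} → Vertex n → Vec Bool n
rank []          = []
rank (false ∷ v) = false ∷ complement (rank v)
rank (true ∷ v)  = true ∷ rank v

unrank : ∀ {n} → Vec Bool n → Vertex n
unrank []          = []
unrank (false ∷ w) = false ∷ unrank (complement w)
unrank (true ∷ w)  = true ∷ unrank w

rank-unrank : ∀ {n} (w : Vec Bool n) → rank (unrank w) ≡ w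
rank-unrank []          = refl
rank-unrank (false ∷ w) = cong (false ∷_) (begin
  complement (rank (unrank (complement w))) ≡⟨ cong complement (rank-unrank (complement w)) ⟩
  complement (complement w)                 ≡⟨ complement-involutive w ⟩
  w                                         ∎)
  where open ≡-Reasoning
rank-unrank (true ∷ w)  = cong (true ∷_) (rank-unrank w)

unrank-rank : ∀ {n} (v : Vertex n) → unrank (rank v) ≡ v
unrank-rank []          = refl
unrank-rank (false ∷ v) =
  cong (false ∷_) (trans (cong unrank (complement-involutive (rank v))) (unrank-rank v))
unrank-rank (true ∷ v)  = cong (true ∷_) (unrank-rank v)

rank-bijective : ∀ {n} → Bijective _≡_ _≡_ (rank {n})
rank-bijective = inverseᵇ⇒bijective
  ( strictlyInverseˡ⇒inverseˡ rank rank-unrank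
  , strictlyInverseʳ⇒inverseʳ rank unrank-rank )

rank-injective : ∀ {n} → Injective _≡_ _≡_ (rank {n})
rank-injective = proj₁ rank-bijective

Edge⇒rank≤ : ∀ {n} {u v : Vertex n} → Edge n u v → rank u ≤bin rank v
Edge⇒rank≤ loop0     = z≤n
Edge⇒rank≤ (low {s = s} {t} e) =
  value-cons-mono false (complement (rank t)) (complement (rank s))
    (value-complement-antitone (rank s) (rank t) (Edge⇒rank≤ e))
Edge⇒rank≤ (high {s = s} {t} e) = value-cons-mono true (rank s) (rank t) (Edge⇒rank≤ e)
Edge⇒rank≤ (cross v)  = <⇒≤ (value-false<true (complement (rank v)) (rank v))

Reach⇒rank≤ : ∀ {n} {u v : Vertex n} → Reach n u v → rank u ≤bin rank v
Reach⇒rank≤ ε       = ≤-refl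
Reach⇒rank≤ (e ◅ r) = ≤-trans (Edge⇒rank≤ e) (Reach⇒rank≤ r)

Reach-low : ∀ {n} {s t : Vertex n} → Reach n s t → Reach (suc n) (false ∷ t) (false ∷ s)
Reach-low {n} = gmap (false ∷_) id ∘ reverse {U = LowEdge} low
  where
  LowEdge : Vertex n → Vertex n → Set
  LowEdge s t = Edge (suc n) (false ∷ s) (false ∷ t)

Reach-high : ∀ {n} {s t : Vertex n} → Reach n s t → Reach (suc n) (true ∷ s) (true ∷ t)
Reach-high = gmap (true ∷_) high

rank≤⇒Reach : ∀ {n} (u v : Vertex n) → rank u ≤bin rank v → Reach n u v
rank≤⇒Reach []          []          _ = loop0 ◅ ε
rank≤⇒Reach (false ∷ s) (false ∷ t) r≤ =
  Reach-low (rank≤⇒Reach t s (value-complement-reflects (rank t) (rank s)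
    (value-cons-cancel false (complement (rank s)) (complement (rank t)) r≤)))
rank≤⇒Reach (true ∷ s)  (true ∷ t)  r≤ =
  Reach-high (rank≤⇒Reach s t (value-cons-cancel true (rank s) (rank t) r≤))
rank≤⇒Reach (true ∷ s)  (false ∷ t) r≤ =
  ⊥-elim (<⇒≱ (value-false<true (complement (rank t)) (rank s)) r≤)
rank≤⇒Reach (false ∷ s) (true ∷ t)  _ with ≤-total (value (rank s)) (value (rank t))
... | inj₁ s≤t = cross s ◅ Reach-high (rank≤⇒Reach s t s≤t)
... | inj₂ t≤s = Reach-low (rank≤⇒Reach t s t≤s) ◅◅ (cross t ◅ ε)

theorem3p5 : (n : ℕ) →
    Σ (Vertex n → Vec Bool n) (λ f →
        Bijective _≡_ _≡_ f
      × ((u v : Vertex n) → (Reach n u v → f u ≤bin f v) × (f u ≤bin f v → Reach n u v)))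
    × ((u v : Vertex n) → Reach n u v → Reach n v u → u ≡ v)
    × ((u v : Vertex n) → Reach n u v ⊎ Reach n v u)
theorem3p5 n =
    (rank , rank-bijective , λ u v → Reach⇒rank≤ , rank≤⇒Reach u v)
  , (λ u v u→v v→u → rank-injective (value-injective (rank u) (rank v)
                         (≤-antisym (Reach⇒rank≤ u→v) (Reach⇒rank≤ v→u))))
  , (λ u v → map (rank≤⇒Reach u v) (rank≤⇒Reach v u)
                 (≤-total (value (rank u)) (value (rank v))))
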